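{- Let $\mathbb M=(M_1,\dots,M_k)$ with $M_i=(E_i,\mathcal B_i)$ matroids, $E=\bigcup_i E_i$, let $\mathbb B=(B_1,\dots,B_k)$ be a feasible basis sequence of $\mathbb M$ and $B:=\bigcup_{i=1}^k B_i$. For $y\in E\setminus B$, let $T_y$ be the set of vertices $x\in E$ such that there is a directed path from $x$ to $y$ in $D(\mathbb M,\mathbb B)$. Then the set of coloops of $\bigvee_{i=1}^k M_i$ equals $B\setminus\bigcup_{y\in E\setminus B}T_y$.
   Context: A basis sequence $(B_1,\dots,B_k)$ has $B_i\in\mathcal B_i$; feasible means the $B_i$ are pairwise disjoint. For a matroid $M=(E',\mathcal B)$ and $B'\in\mathcal B$, the exchangeability graph $D(M,B')$ is the directed graph on $E'$ with arcs $(x,y)$ for $x\in B'$, $y\in E'\setminus B'$, $B'-x+y\in\mathcal B$. $D(\mathbb M,\mathbb B)$ is the union of $D(M_i,B_i)$ over $i\in[k]$, on vertex set $E$. The matroid union $\bigvee_i M_i$ has ground set $E$ and bases the inclusion-maximal sets among $\{\bigcup_i B'_i: B'_i\in\mathcal B_i\}$. A coloop is an element in every basis. -}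

module Defs where

open import Level using (Level; suc; _⊔_)
open import Data.Nat using (ℕ)
open import Data.Fin using (Fin)
open import Data.Fin.Subset using (Subset; _∈_; _∉_; _⊆_; _∪_; _─_; ⁅_⁆)
open import Data.Product using (Σ; ∃; ∃-syntax; _×_)
open import Relation.Binary.PropositionalEquality using (_≡_)
open import Relation.Nullary using (¬_)
open import Relation.Binary.Construct.Closure.ReflexiveTransitive using (Star)

-- All matroids live inside a common finite universe Fin n; a matroid has its own
-- ground set E_i ⊆ Fin n and is given by its family of bases (basis axioms).
record Matroid (n : ℕ) : Set₁ where
  field
    ground      : Subset n
    IsBase      : Subset n → Set
    base⊆ground : ∀ {B} → IsBase B → B ⊆ ground
    base-exists : ∃[ B ] IsBase B
    exchange    : ∀ {B₁ B₂} → IsBase B₁ → IsBase B₂ →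
                  ∀ {x} → x ∈ B₁ → x ∉ B₂ →
                  ∃[ y ] (y ∈ B₂ × y ∉ B₁ × IsBase ((B₁ ─ ⁅ x ⁆) ∪ ⁅ y ⁆))

open Matroid public

module _ {n k : ℕ} (M : Fin k → Matroid n) where

  InE : Fin n → Set
  InE x = ∃[ i ] x ∈ ground (M i)

  IsBasisSeq : (Fin k → Subset n) → Set
  IsBasisSeq Bs = ∀ i → IsBase (M i) (Bs i)

  Feasible : (Fin k → Subset n) → Set
  Feasible Bs = IsBasisSeq Bs × (∀ i j x → x ∈ Bs i → x ∈ Bs j → i ≡ j)

  InUnion : (Fin k → Subset n) → Fin n → Set
  InUnion Bs x = ∃[ i ] x ∈ Bs i

  -- ⋃ᵢ B'ᵢ is a basis of the matroid union: it is inclusion-maximal among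
  -- all sets ⋃ᵢ B''ᵢ with B'' a basis sequence
  IsUnionBasisOf : (Fin k → Subset n) → Set
  IsUnionBasisOf Bs′ = IsBasisSeq Bs′ ×
    (∀ Bs″ → IsBasisSeq Bs″ →
       (∀ x → InUnion Bs′ x → InUnion Bs″ x) →
       (∀ x → InUnion Bs″ x → InUnion Bs′ x))

  IsUnionColoop : Fin n → Set
  IsUnionColoop x = InE x × (∀ Bs′ → IsUnionBasisOf Bs′ → InUnion Bs′ x)

  Arc : (Fin k → Subset n) → Fin n → Fin n → Set
  Arc Bs x y = ∃[ i ] (x ∈ Bs i × y ∈ ground (M i) × y ∉ Bs i ×
                       IsBase (M i) ((Bs i ─ ⁅ x ⁆) ∪ ⁅ y ⁆))

  Path : (Fin k → Subset n) → Fin n → Fin n → Set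
  Path Bs = Star (Arc Bs)

-- Let R be the set of elements from which D(𝕄, 𝔹) reaches E ∖ B. Every feasible sequence is a basis
-- of the union, since bases of each Mᵢ are equinumerous. If x reaches some y ∉ B, take a shortest such
-- walk and exchange along its last arc (u, y): the sequence stays feasible, u leaves the union, and by
-- minimality the rest of the walk survives as a shorter escaping walk from x to u. By induction on the
-- length, x itself lies outside some union basis. Conversely, no arc of D(Mᵢ, Bᵢ) enters R from
-- outside, which lets each Bᵢ be exchanged towards any union basis 𝔹′ inside R only, giving bases
-- Dᵢ ⊇ (Bᵢ ∖ R) ∪ (B′ᵢ ∩ R). Then ⋃ 𝔹′ ⊆ ⋃ D, so maximality of 𝔹′ gives B ∖ R ⊆ ⋃ D ⊆ ⋃ 𝔹′.

module Submission where

open import Defs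
open import Data.Nat using (ℕ)
open import Data.Fin using (Fin)
open import Data.Fin.Subset using (Subset)
open import Data.Product using (_×_)
open import Relation.Nullary using (¬_)
open import Function.Bundles using (_⇔_)

open import Data.Nat using (zero; suc; _+_; _≤_; _<_; s≤s)
open import Data.Nat.Induction using (<-wellFounded)
open import Data.Nat.Properties
  using (+-suc; +-identityʳ; m+n≤o⇒m≤o; ≤-reflexive; ≤-refl; ≤-trans; <-irrefl; m≤n⇒m≤1+n; +-monoʳ-≤;
         +-0-monoid; module ≤-Reasoning)
open import Algebra.Properties.Monoid.Sum +-0-monoid using (sum; sum-cong-≗)
open import Data.Fin using (zero; suc)
open import Data.Fin.Properties using (_≟_; any?; suc-injective; 0≢1+n)
open import Data.Fin.Subset using (inside; outside; _∈_; _∉_; _⊆_; _∪_; _∩_; _─_; ⁅_⁆; ∣_∣; ⊥; Empty)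
open import Data.Fin.Subset.Properties
  using (_∈?_; x∈p∪q⁻; x∈p∪q⁺; x∈p∩q⁻; x∈⁅x⁆; x∈⁅y⁆⇒x≡y; x∉⁅y⁆⇒x≢y; x∈p∧x∉q⇒x∈p─q; x∈p∧x≢y⇒x∈p-y;
         ⊆-antisym; p⊂q⇒∣p∣<∣q∣; Empty-unique; ∣⊥∣≡0; ∣⁅x⁆∣≡1; ∉⊥)
open import Data.Vec.Base using ([]; _∷_; here; there)
open import Data.Vec.Functional using (foldr; updateAt)
open import Data.Vec.Functional.Properties using (updateAt-updates; updateAt-minimal)
open import Data.Product using (∃-syntax; _,_; proj₁; proj₂)
open import Data.Sum using (_⊎_; inj₁; inj₂)
open import Function using (_∘_)
open import Function.Bundles using (mk⇔)
open import Induction.WellFounded using (Acc; acc)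
open import Relation.Binary.Construct.Closure.ReflexiveTransitive using (ε; _◅_)
open import Relation.Binary.PropositionalEquality
  using (_≡_; _≢_; refl; sym; trans; cong; subst; module ≡-Reasoning)
open import Relation.Nullary using (yes; no; contradiction)
open import Relation.Nullary.Decidable using (decidable-stable; ¬¬-excluded-middle; _×-dec_; ¬?)
open import Relation.Unary using (Decidable)

private variable
  n k l : ℕ
  p q A D : Subset n
  a b c d u v w x x₁ y y₁ z : Fin n
  Bs : Fin k → Subset n
  j : Fin k

x∈p─q⁻ : ∀ (p q : Subset n) → x ∈ p ─ q → x ∈ p × x ∉ q
x∈p─q⁻ (inside  ∷ p) (outside ∷ q) here      = here , λ ()
x∈p─q⁻ {x = zero} (inside  ∷ p) (inside  ∷ q) ()
x∈p─q⁻ {x = zero} (outside ∷ p) (inside  ∷ q) ()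
x∈p─q⁻ {x = zero} (outside ∷ p) (outside ∷ q) ()
x∈p─q⁻ (_       ∷ p) (_       ∷ q) (there h) with x∈p─q⁻ p q h
... | x∈p , x∉q = there x∈p , λ { (there x∈q) → x∉q x∈q }

⊆⊎∃∉ : ∀ (p q : Subset n) → p ⊆ q ⊎ ∃[ x ] (x ∈ p × x ∉ q)
⊆⊎∃∉ p q with any? (λ x → x ∈? p ×-dec ¬? (x ∈? q))
... | yes witness = inj₂ witness
... | no  none    = inj₁ λ {x} x∈p → decidable-stable (x ∈? q) λ x∉q → none (x , x∈p , x∉q)

∣p∪q∣+∣p∩q∣≡∣p∣+∣q∣ : ∀ (p q : Subset n) → ∣ p ∪ q ∣ + ∣ p ∩ q ∣ ≡ ∣ p ∣ + ∣ q ∣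
∣p∪q∣+∣p∩q∣≡∣p∣+∣q∣ []            []            = refl
∣p∪q∣+∣p∩q∣≡∣p∣+∣q∣ (outside ∷ p) (outside ∷ q) = ∣p∪q∣+∣p∩q∣≡∣p∣+∣q∣ p q
∣p∪q∣+∣p∩q∣≡∣p∣+∣q∣ (inside  ∷ p) (outside ∷ q) = cong suc (∣p∪q∣+∣p∩q∣≡∣p∣+∣q∣ p q)
∣p∪q∣+∣p∩q∣≡∣p∣+∣q∣ (outside ∷ p) (inside  ∷ q) =
  trans (cong suc (∣p∪q∣+∣p∩q∣≡∣p∣+∣q∣ p q)) (sym (+-suc ∣ p ∣ ∣ q ∣))
∣p∪q∣+∣p∩q∣≡∣p∣+∣q∣ (inside  ∷ p) (inside  ∷ q) = cong suc (begin
  ∣ p ∪ q ∣ + suc ∣ p ∩ q ∣  ≡⟨ +-suc ∣ p ∪ q ∣ ∣ p ∩ q ∣ ⟩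
  suc (∣ p ∪ q ∣ + ∣ p ∩ q ∣) ≡⟨ cong suc (∣p∪q∣+∣p∩q∣≡∣p∣+∣q∣ p q) ⟩
  suc (∣ p ∣ + ∣ q ∣)         ≡⟨ +-suc ∣ p ∣ ∣ q ∣ ⟨
  ∣ p ∣ + suc ∣ q ∣           ∎)
  where open ≡-Reasoning

∣p∪q∣≤∣p∣+∣q∣ : ∀ (p q : Subset n) → ∣ p ∪ q ∣ ≤ ∣ p ∣ + ∣ q ∣
∣p∪q∣≤∣p∣+∣q∣ p q = m+n≤o⇒m≤o ∣ p ∪ q ∣ (≤-reflexive (∣p∪q∣+∣p∩q∣≡∣p∣+∣q∣ p q))

∣p∪q∣≡∣p∣+∣q∣ : ∀ (p q : Subset n) → (∀ {x} → x ∈ p → x ∉ q) → ∣ p ∪ q ∣ ≡ ∣ p ∣ + ∣ q ∣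
∣p∪q∣≡∣p∣+∣q∣ {n} p q disjoint = begin
  ∣ p ∪ q ∣                   ≡⟨ +-identityʳ ∣ p ∪ q ∣ ⟨
  ∣ p ∪ q ∣ + 0               ≡⟨ cong (∣ p ∪ q ∣ +_) (sym (trans (cong ∣_∣ (Empty-unique p∩q-empty)) (∣⊥∣≡0 n))) ⟩
  ∣ p ∪ q ∣ + ∣ p ∩ q ∣       ≡⟨ ∣p∪q∣+∣p∩q∣≡∣p∣+∣q∣ p q ⟩
  ∣ p ∣ + ∣ q ∣               ∎
  where
  open ≡-Reasoning
  p∩q-empty : Empty (p ∩ q)
  p∩q-empty (x , x∈p∩q) = let x∈p , x∈q = x∈p∩q⁻ p q x∈p∩q in disjoint x∈p x∈q

infixl 5 _-_+_
_-_+_ : Subset n → Fin n → Fin n → Subset n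
A - z + w = (A ─ ⁅ z ⁆) ∪ ⁅ w ⁆

∈-+⁻ : u ∈ A - z + w → (u ∈ A × u ≢ z) ⊎ u ≡ w
∈-+⁻ {A = A} {z} {w} u∈ with x∈p∪q⁻ (A ─ ⁅ z ⁆) ⁅ w ⁆ u∈
... | inj₁ u∈A-z = let u∈A , u∉⁅z⁆ = x∈p─q⁻ A ⁅ z ⁆ u∈A-z in inj₁ (u∈A , x∉⁅y⁆⇒x≢y u∉⁅z⁆)
... | inj₂ u∈⁅w⁆ = inj₂ (x∈⁅y⁆⇒x≡y w u∈⁅w⁆)

∈-+⁺ˡ : u ∈ A → u ≢ z → u ∈ A - z + w
∈-+⁺ˡ u∈A u≢z = x∈p∪q⁺ (inj₁ (x∈p∧x≢y⇒x∈p-y u∈A u≢z))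

∈-+⁺ʳ : w ∈ A - z + w
∈-+⁺ʳ {w = w} = x∈p∪q⁺ (inj₂ (x∈⁅x⁆ w))

∈-+∧∉⇒≡ : u ∈ A - z + w → u ∉ A → u ≡ w
∈-+∧∉⇒≡ u∈ u∉A with ∈-+⁻ u∈
... | inj₁ (u∈A , _) = contradiction u∈A u∉A
... | inj₂ u≡w       = u≡w

∉-+ : z ≢ w → z ∉ A - z + w
∉-+ z≢w z∈ with ∈-+⁻ z∈
... | inj₁ (_ , z≢z) = z≢z refl
... | inj₂ z≡w       = z≢w z≡w

∉-+ˡ : u ∉ A → u ≢ w → u ∉ A - z + w
∉-+ˡ u∉A u≢w u∈ with ∈-+⁻ u∈
... | inj₁ (u∈A , _) = u∉A u∈A
... | inj₂ u≡w       = u≢w u≡w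

-+-self : z ∈ A → A - z + z ≡ A
-+-self {z = z} {A = A} z∈A = ⊆-antisym ⊆A A⊆
  where
  ⊆A : A - z + z ⊆ A
  ⊆A u∈ with ∈-+⁻ u∈
  ... | inj₁ (u∈A , _) = u∈A
  ... | inj₂ refl      = z∈A
  A⊆ : A ⊆ A - z + z
  A⊆ {u} u∈A with u ≟ z
  ... | yes refl = ∈-+⁺ʳ
  ... | no  u≢z  = ∈-+⁺ˡ u∈A u≢z

-+-reinsert : z ∈ A → v ≢ z → v ≢ w → (A - z + w) - v + z ≡ A - v + w
-+-reinsert {z = z} {A = A} {v = v} {w = w} z∈A v≢z v≢w = ⊆-antisym ⊆rhs ⊆lhs
  where
  ⊆rhs : (A - z + w) - v + z ⊆ A - v + w
  ⊆rhs u∈ with ∈-+⁻ u∈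
  ... | inj₂ refl = ∈-+⁺ˡ z∈A (λ z≡v → v≢z (sym z≡v))
  ... | inj₁ (u∈A-z+w , u≢v) with ∈-+⁻ u∈A-z+w
  ... | inj₁ (u∈A , _) = ∈-+⁺ˡ u∈A u≢v
  ... | inj₂ refl      = ∈-+⁺ʳ
  ⊆lhs : A - v + w ⊆ (A - z + w) - v + z
  ⊆lhs {u} u∈ with ∈-+⁻ u∈ | u ≟ z
  ... | inj₂ refl        | _        = ∈-+⁺ˡ ∈-+⁺ʳ (λ w≡v → v≢w (sym w≡v))
  ... | inj₁ _           | yes refl = ∈-+⁺ʳ
  ... | inj₁ (u∈A , u≢v) | no u≢z   = ∈-+⁺ˡ (∈-+⁺ˡ u∈A u≢z) u≢v

-+-cancel : w ∉ A → (A - z + w) - w + v ≡ A - z + v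
-+-cancel {w = w} {A = A} {z = z} {v = v} w∉A = ⊆-antisym ⊆rhs ⊆lhs
  where
  ⊆rhs : (A - z + w) - w + v ⊆ A - z + v
  ⊆rhs u∈ with ∈-+⁻ u∈
  ... | inj₂ refl = ∈-+⁺ʳ
  ... | inj₁ (u∈A-z+w , u≢w) with ∈-+⁻ u∈A-z+w
  ... | inj₁ (u∈A , u≢z) = ∈-+⁺ˡ u∈A u≢z
  ... | inj₂ u≡w         = contradiction u≡w u≢w
  ⊆lhs : A - z + v ⊆ (A - z + w) - w + v
  ⊆lhs u∈ with ∈-+⁻ u∈
  ... | inj₂ refl        = ∈-+⁺ʳ
  ... | inj₁ (u∈A , u≢z) = ∈-+⁺ˡ (∈-+⁺ˡ u∈A u≢z) λ { refl → w∉A u∈A }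

-+-comm-⊆ : c ≢ a → c ≢ b → (A - a + c) - b + d ⊆ (A - b + c) - a + d
-+-comm-⊆ c≢a c≢b u∈ with ∈-+⁻ u∈
... | inj₂ refl = ∈-+⁺ʳ
... | inj₁ (u∈A-a+c , u≢b) with ∈-+⁻ u∈A-a+c
... | inj₁ (u∈A , u≢a) = ∈-+⁺ˡ (∈-+⁺ˡ u∈A u≢b) u≢a
... | inj₂ refl        = ∈-+⁺ˡ ∈-+⁺ʳ c≢a

-+-comm : c ≢ a → c ≢ b → (A - a + c) - b + d ≡ (A - b + c) - a + d
-+-comm c≢a c≢b = ⊆-antisym (-+-comm-⊆ c≢a c≢b) (-+-comm-⊆ c≢b c≢a)

-+-undo : b ∈ A → b ≢ a → c ∉ A → c ≢ d → ((A - a + c) - b + d) - c + b ≡ A - a + d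
-+-undo b∈A b≢a c∉A c≢d =
  trans (-+-reinsert (∈-+⁺ˡ b∈A b≢a) (λ { refl → c∉A b∈A }) c≢d) (-+-cancel c∉A)

∣-+∣≡∣─∣+1 : w ∉ A ─ ⁅ z ⁆ → ∣ A - z + w ∣ ≡ ∣ A ─ ⁅ z ⁆ ∣ + 1
∣-+∣≡∣─∣+1 {w = w} {A = A} {z = z} w∉ = trans
  (∣p∪q∣≡∣p∣+∣q∣ (A ─ ⁅ z ⁆) ⁅ w ⁆ λ u∈ u∈⁅w⁆ → w∉ (subst (_∈ A ─ ⁅ z ⁆) (x∈⁅y⁆⇒x≡y w u∈⁅w⁆) u∈))
  (cong (∣ A ─ ⁅ z ⁆ ∣ +_) (∣⁅x⁆∣≡1 w))

∣-+∣≡∣∣ : z ∈ A → w ∉ A → ∣ A - z + w ∣ ≡ ∣ A ∣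
∣-+∣≡∣∣ {z = z} {A = A} {w = w} z∈A w∉A = begin
  ∣ A - z + w ∣         ≡⟨ ∣-+∣≡∣─∣+1 (λ w∈ → w∉A (proj₁ (x∈p─q⁻ A ⁅ z ⁆ w∈))) ⟩
  ∣ A ─ ⁅ z ⁆ ∣ + 1     ≡⟨ ∣-+∣≡∣─∣+1 (λ z∈ → proj₂ (x∈p─q⁻ A ⁅ z ⁆ z∈) (x∈⁅x⁆ z)) ⟨
  ∣ A - z + z ∣         ≡⟨ cong ∣_∣ (-+-self z∈A) ⟩
  ∣ A ∣                 ∎
  where open ≡-Reasoning

∣-+─∣<∣─∣ : x ∈ A → x ∉ q → y ∈ q → ∣ (A - x + y) ─ q ∣ < ∣ A ─ q ∣
∣-+─∣<∣─∣ {x = x} {A = A} {q = q} {y = y} x∈A x∉q y∈q =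
  p⊂q⇒∣p∣<∣q∣ (shrinks , x , x∈p∧x∉q⇒x∈p─q x∈A x∉q , x∉)
  where
  shrinks : (A - x + y) ─ q ⊆ A ─ q
  shrinks u∈ with x∈p─q⁻ (A - x + y) q u∈
  ... | u∈A-x+y , u∉q with ∈-+⁻ u∈A-x+y
  ... | inj₁ (u∈A , _) = x∈p∧x∉q⇒x∈p─q u∈A u∉q
  ... | inj₂ refl      = contradiction y∈q u∉q
  x∉ : x ∉ (A - x + y) ─ q
  x∉ x∈ = ∉-+ (λ { refl → x∉q y∈q }) (proj₁ (x∈p─q⁻ (A - x + y) q x∈))

∣─-+∣<∣─∣ : z ∉ q → w ∈ q → w ∉ A → ∣ q ─ (A - z + w) ∣ < ∣ q ─ A ∣
∣─-+∣<∣─∣ {z = z} {q = q} {w = w} {A = A} z∉q w∈q w∉A =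
  p⊂q⇒∣p∣<∣q∣ (shrinks , w , x∈p∧x∉q⇒x∈p─q w∈q w∉A , λ w∈ → proj₂ (x∈p─q⁻ q (A - z + w) w∈) ∈-+⁺ʳ)
  where
  shrinks : q ─ (A - z + w) ⊆ q ─ A
  shrinks {u} u∈ with x∈p─q⁻ q (A - z + w) u∈ | u ∈? A
  ... | u∈q , u∉ | no u∉A  = x∈p∧x∉q⇒x∈p─q u∈q u∉A
  ... | u∈q , u∉ | yes u∈A = contradiction (∈-+⁺ˡ u∈A λ { refl → z∉q u∈q }) u∉

PairwiseDisjoint : (Fin k → Subset n) → Set
PairwiseDisjoint Bs = ∀ i j x → x ∈ Bs i → x ∈ Bs j → i ≡ j

⋃ : (Fin k → Subset n) → Subset n
⋃ = foldr _∪_ ⊥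

∈⋃⁻ : ∀ (Bs : Fin k → Subset n) → x ∈ ⋃ Bs → ∃[ i ] x ∈ Bs i
∈⋃⁻ {k = zero}  Bs x∈ = contradiction x∈ ∉⊥
∈⋃⁻ {k = suc k} Bs x∈ with x∈p∪q⁻ (Bs zero) (⋃ (Bs ∘ suc)) x∈
... | inj₁ x∈B₀ = zero , x∈B₀
... | inj₂ x∈⋃  = let i , x∈Bᵢ = ∈⋃⁻ (Bs ∘ suc) x∈⋃ in suc i , x∈Bᵢ

∈⋃⁺ : ∀ (Bs : Fin k → Subset n) i → x ∈ Bs i → x ∈ ⋃ Bs
∈⋃⁺ Bs zero    x∈B₀ = x∈p∪q⁺ (inj₁ x∈B₀)
∈⋃⁺ Bs (suc i) x∈Bᵢ = x∈p∪q⁺ (inj₂ (∈⋃⁺ (Bs ∘ suc) i x∈Bᵢ))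

∣⋃∣≤∑∣∣ : ∀ (Bs : Fin k → Subset n) → ∣ ⋃ Bs ∣ ≤ sum (∣_∣ ∘ Bs)
∣⋃∣≤∑∣∣ {k = zero}  {n} Bs = ≤-reflexive (∣⊥∣≡0 n)
∣⋃∣≤∑∣∣ {k = suc k} Bs =
  ≤-trans (∣p∪q∣≤∣p∣+∣q∣ (Bs zero) (⋃ (Bs ∘ suc))) (+-monoʳ-≤ ∣ Bs zero ∣ (∣⋃∣≤∑∣∣ (Bs ∘ suc)))

∣⋃∣≡∑∣∣ : ∀ (Bs : Fin k → Subset n) → PairwiseDisjoint Bs → ∣ ⋃ Bs ∣ ≡ sum (∣_∣ ∘ Bs)
∣⋃∣≡∑∣∣ {k = zero}  {n} Bs _        = ∣⊥∣≡0 n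
∣⋃∣≡∑∣∣ {k = suc k} Bs disjoint = trans
  (∣p∪q∣≡∣p∣+∣q∣ (Bs zero) (⋃ (Bs ∘ suc)) λ x∈B₀ x∈⋃ →
    let i , x∈Bᵢ = ∈⋃⁻ (Bs ∘ suc) x∈⋃ in 0≢1+n (disjoint zero (suc i) _ x∈B₀ x∈Bᵢ))
  (cong (∣ Bs zero ∣ +_) (∣⋃∣≡∑∣∣ (Bs ∘ suc) λ i j x x∈Bᵢ x∈Bⱼ → suc-injective (disjoint (suc i) (suc j) x x∈Bᵢ x∈Bⱼ)))

∈-updateAt⁻ : ∀ (Bs : Fin k → Subset n) {f i j x} → x ∈ updateAt Bs j f i →
              (i ≡ j × x ∈ f (Bs j)) ⊎ (i ≢ j × x ∈ Bs i)
∈-updateAt⁻ Bs {i = i} {j} {x} x∈ with i ≟ j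
... | yes refl = inj₁ (refl , subst (x ∈_) (updateAt-updates i Bs) x∈)
... | no  i≢j  = inj₂ (i≢j , subst (x ∈_) (updateAt-minimal i j Bs i≢j) x∈)

¬¬-decidable : ∀ (P : Fin n → Set) → ¬ ¬ Decidable P
¬¬-decidable {n = zero}  P undecided = undecided λ ()
¬¬-decidable {n = suc n} P undecided = ¬¬-excluded-middle λ P₀? →
  ¬¬-decidable (P ∘ suc) λ P? → undecided λ { zero → P₀? ; (suc i) → P? i }

module _ (M : Matroid n) where

  base⊆base⇒≡ : IsBase M p → IsBase M q → p ⊆ q → p ≡ q
  base⊆base⇒≡ {p = p} {q = q} bp bq p⊆q = ⊆-antisym p⊆q q⊆p
    where
    q⊆p : q ⊆ p
    q⊆p {u} u∈q with u ∈? p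
    ... | yes u∈p = u∈p
    ... | no  u∉p = let y , y∈p , y∉q , _ = exchange M bq bp u∈q u∉p in contradiction (p⊆q y∈p) y∉q

  bases-equinumerous : IsBase M p → IsBase M q → ∣ p ∣ ≡ ∣ q ∣
  bases-equinumerous {q = q} bp bq = go (<-wellFounded _) bp
    where
    go : ∀ {p} → Acc _<_ ∣ p ─ q ∣ → IsBase M p → ∣ p ∣ ≡ ∣ q ∣
    go {p} (acc rec) bp with ⊆⊎∃∉ p q
    ... | inj₁ p⊆q = cong ∣_∣ (base⊆base⇒≡ bp bq p⊆q)
    ... | inj₂ (x , x∈p , x∉q) =
      let y , y∈q , y∉p , bp′ = exchange M bp bq x∈p x∉q
      in trans (sym (∣-+∣≡∣∣ x∈p y∉p)) (go (rec (∣-+─∣<∣─∣ x∈p x∉q y∈q)) bp′)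

  -- Exchanging y₁ out of F = p - {x₁, x} + {y₁, y} must bring back x₁ or x.
  two-exchanges⇒one : IsBase M p → IsBase M ((p - x₁ + y₁) - x + y) →
                      x₁ ∈ p → x ∈ p → x ≢ x₁ → y₁ ∉ p → y₁ ≢ y →
                      IsBase M (p - x₁ + y) ⊎ IsBase M (p - x + y)
  two-exchanges⇒one {p = p} {x₁ = x₁} {y₁ = y₁} {x = x} {y = y} bp bF x₁∈p x∈p x≢x₁ y₁∉p y₁≢y
    with exchange M bF bp (∈-+⁺ˡ ∈-+⁺ʳ y₁≢x) y₁∉p
    where
    y₁≢x : y₁ ≢ x
    y₁≢x refl = y₁∉p x∈p
  ... | w , w∈p , w∉F , bG with w ≟ x | w ≟ x₁
  ... | yes refl | _        = inj₁ (subst (IsBase M) (-+-undo x∈p x≢x₁ y₁∉p y₁≢y) bG)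
  ... | no _     | yes refl = inj₂ (subst (IsBase M) eq bG)
    where
    eq : ((p - x₁ + y₁) - x + y) - y₁ + x₁ ≡ p - x + y
    eq = trans (cong (_- y₁ + x₁) (-+-comm (λ { refl → y₁∉p x₁∈p }) λ { refl → y₁∉p x∈p }))
               (-+-undo x₁∈p (x≢x₁ ∘ sym) y₁∉p y₁≢y)
  ... | no w≢x   | no w≢x₁  = contradiction (∈-+⁺ˡ (∈-+⁺ˡ w∈p w≢x₁) w≢x) w∉F

  dual-exchange : IsBase M p → IsBase M q → y ∈ q → y ∉ p →
                  ∃[ x ] (x ∈ p × x ∉ q × IsBase M (p - x + y))
  dual-exchange {q = q} {y = y} bp bq y∈q y∉p = go (<-wellFounded _) bp y∉p
    where
    go : ∀ {p} → Acc _<_ ∣ p ─ q ∣ → IsBase M p → y ∉ p → ∃[ x ] (x ∈ p × x ∉ q × IsBase M (p - x + y))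
    go {p} (acc rec) bp y∉p with ⊆⊎∃∉ p q
    ... | inj₁ p⊆q = contradiction (subst (y ∈_) (sym (base⊆base⇒≡ bp bq p⊆q)) y∈q) y∉p
    ... | inj₂ (x₁ , x₁∈p , x₁∉q) with exchange M bp bq x₁∈p x₁∉q
    ... | y₁ , y₁∈q , y₁∉p , bp₁ with y₁ ≟ y
    ... | yes refl  = x₁ , x₁∈p , x₁∉q , bp₁
    ... | no  y₁≢y with go (rec (∣-+─∣<∣─∣ x₁∈p x₁∉q y₁∈q)) bp₁ (∉-+ˡ y∉p (y₁≢y ∘ sym))
    ... | x , x∈p₁ , x∉q , bF with ∈-+⁻ x∈p₁
    ... | inj₂ refl          = contradiction y₁∈q x∉q
    ... | inj₁ (x∈p , x≢x₁) with two-exchanges⇒one bp bF x₁∈p x∈p x≢x₁ y₁∉p y₁≢y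
    ... | inj₁ bp′ = x₁ , x₁∈p , x₁∉q , bp′
    ... | inj₂ bp′ = x  , x∈p  , x∉q  , bp′

  -- Arc M Bs u v is definitionally ∃[ i ] ExchangeArc (M i) (Bs i) u v.
  ExchangeArc : Subset n → Fin n → Fin n → Set
  ExchangeArc D z w = z ∈ D × w ∈ ground M × w ∉ D × IsBase M (D - z + w)

  exchange-persists : ExchangeArc D z y → ExchangeArc D a b → a ≢ z → b ≢ y → ¬ IsBase M (D - a + y) →
                      ExchangeArc (D - z + y) a b
  exchange-persists {D = D} {z = z} {y = y} {a = a} {b = b}
                    (z∈D , _ , y∉D , bzy) (a∈D , b∈E , b∉D , bab) a≢z b≢y ¬bay =
    ∈-+⁺ˡ a∈D a≢z , b∈E , ∉-+ˡ b∉D b≢y , base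
    where
    base : IsBase M ((D - z + y) - a + b)
    base with exchange M bzy bab (∈-+⁺ˡ a∈D a≢z) (∉-+ λ { refl → b∉D a∈D })
    ... | y′ , y′∈ , y′∉ , bG with ∈-+⁻ y′∈
    ... | inj₂ refl = bG
    ... | inj₁ (y′∈D , _) with y′ ≟ z
    ... | yes refl = contradiction (subst (IsBase M) (-+-reinsert z∈D a≢z λ { refl → y∉D a∈D }) bG) ¬bay
    ... | no y′≢z  = contradiction (∈-+⁺ˡ y′∈D y′≢z) y′∉

  PredecessorClosed : (Fin n → Set) → Subset n → Set
  PredecessorClosed R D = ∀ {z w} → ExchangeArc D z w → R w → R z

  predecessorClosed-exchange : ∀ {R} → IsBase M D → PredecessorClosed R D →
                               ExchangeArc D z w → R w → PredecessorClosed R (D - z + w)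
  predecessorClosed-exchange {D = D} {z = z} {w = w} {R = R} bD closed (z∈D , w∈E , w∉D , _) Rw
                             {z′} {w′} (z′∈D′ , w′∈E , w′∉D′ , bF) Rw′ with ∈-+⁻ z′∈D′
  ... | inj₂ refl         = Rw
  ... | inj₁ (z′∈D , z′≢z) with w′ ≟ z
  ... | yes refl = closed (z′∈D , w∈E , w∉D , subst (IsBase M) reinsert bF) Rw
    where reinsert = -+-reinsert z∈D z′≢z λ { refl → w∉D z′∈D }
  ... | no w′≢z with exchange M bD bF z′∈D (∉-+ λ { refl → w′∉D′ z′∈D′ })
  ... | y , y∈F , y∉D , bY = closed (z′∈D , base⊆ground M bF y∈F , y∉D , bY) Ry
    where
    Ry : R y
    Ry with ∈-+⁻ y∈F
    ... | inj₂ refl       = Rw′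
    ... | inj₁ (y∈D′ , _) = subst R (sym (∈-+∧∉⇒≡ y∈D′ y∉D)) Rw

  -- Move towards q inside R: a dual exchange brings in some w ∈ q ∩ R, and predecessor-closedness
  -- forces the element it displaces into R, so p ∖ R is never touched.
  interpolating-base : ∀ {R} → Decidable R → IsBase M p → PredecessorClosed R p → IsBase M q →
                       ∃[ D ] (IsBase M D × (∀ {u} → u ∈ p → ¬ R u → u ∈ D) × (∀ {u} → u ∈ q → R u → u ∈ D))
  interpolating-base {p = p} {q = q} {R = R} R? bp closed bq = go (<-wellFounded _) bp closed (λ u∈p _ → u∈p)
    where
    go : ∀ {D} → Acc _<_ ∣ q ─ D ∣ → IsBase M D → PredecessorClosed R D → (∀ {u} → u ∈ p → ¬ R u → u ∈ D) →
         ∃[ D ] (IsBase M D × (∀ {u} → u ∈ p → ¬ R u → u ∈ D) × (∀ {u} → u ∈ q → R u → u ∈ D))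
    go {D} (acc rec) bD closed keeps with any? (λ u → u ∈? q ×-dec R? u ×-dec ¬? (u ∈? D))
    ... | no none = D , bD , keeps , λ {u} u∈q Ru → decidable-stable (u ∈? D) λ u∉D → none (u , u∈q , Ru , u∉D)
    ... | yes (w , w∈q , Rw , w∉D) with dual-exchange bD bq w∈q w∉D
    ... | z , z∈D , z∉q , bD′ = go (rec (∣─-+∣<∣─∣ z∉q w∈q w∉D))
                                   bD′ (predecessorClosed-exchange bD closed arc Rw) keeps′
      where
      arc : ExchangeArc D z w
      arc = z∈D , base⊆ground M bq w∈q , w∉D , bD′
      keeps′ : ∀ {u} → u ∈ p → ¬ R u → u ∈ D - z + w
      keeps′ u∈p ¬Ru = ∈-+⁺ˡ (keeps u∈p ¬Ru) λ { refl → ¬Ru (closed arc Rw) }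

module _ (M : Fin k → Matroid n) where

  InUnion? : ∀ (Bs : Fin k → Subset n) → Decidable (InUnion M Bs)
  InUnion? Bs x = any? λ i → x ∈? Bs i

  feasible⇒unionBasis : Feasible M Bs → IsUnionBasisOf M Bs
  feasible⇒unionBasis {Bs = Bs} (bases , disjoint) = bases , maximal
    where
    maximal : ∀ Bs″ → IsBasisSeq M Bs″ → (∀ x → InUnion M Bs x → InUnion M Bs″ x) →
              ∀ x → InUnion M Bs″ x → InUnion M Bs x
    maximal Bs″ bases″ Bs⊆Bs″ x (i , x∈Bs″ᵢ) = decidable-stable (InUnion? Bs x) λ x∉Bs →
      <-irrefl refl (begin-strict
        ∣ ⋃ Bs ∣            <⟨ p⊂q⇒∣p∣<∣q∣ (⋃Bs⊆⋃Bs″ , x , ∈⋃⁺ Bs″ i x∈Bs″ᵢ , x∉Bs ∘ ∈⋃⁻ Bs) ⟩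
        ∣ ⋃ Bs″ ∣           ≤⟨ ∣⋃∣≤∑∣∣ Bs″ ⟩
        sum (∣_∣ ∘ Bs″)     ≡⟨ sum-cong-≗ (λ j → bases-equinumerous (M j) (bases″ j) (bases j)) ⟩
        sum (∣_∣ ∘ Bs)      ≡⟨ ∣⋃∣≡∑∣∣ Bs disjoint ⟨
        ∣ ⋃ Bs ∣            ∎)
      where
      open ≤-Reasoning
      ⋃Bs⊆⋃Bs″ : ⋃ Bs ⊆ ⋃ Bs″
      ⋃Bs⊆⋃Bs″ y∈ = let j , y∈Bs″ⱼ = Bs⊆Bs″ _ (∈⋃⁻ Bs y∈) in ∈⋃⁺ Bs″ j y∈Bs″ⱼ

  data Walk (Bs : Fin k → Subset n) (x : Fin n) : Fin n → ℕ → Set where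
    []  : Walk Bs x x 0
    _▷_ : Walk Bs x u l → Arc M Bs u v → Walk Bs x v (suc l)

  _◁_ : Arc M Bs x u → Walk Bs u v l → Walk Bs x v (suc l)
  e ◁ []      = [] ▷ e
  e ◁ (w ▷ f) = (e ◁ w) ▷ f

  path⇒walk : Path M Bs x y → ∃[ l ] Walk Bs x y l
  path⇒walk ε       = 0 , []
  path⇒walk (e ◅ p) = let l , w = path⇒walk p in suc l , e ◁ w

  NoEscapeWithin : (Fin k → Subset n) → Fin n → ℕ → Set
  NoEscapeWithin Bs x l = ∀ {y m} → m ≤ l → ¬ InUnion M Bs y → ¬ Walk Bs x y m

  exchangeAt : (Fin k → Subset n) → Fin k → Fin n → Fin n → Fin k → Subset n
  exchangeAt Bs j u y = updateAt Bs j (_- u + y)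

  exchangeAt-feasible : Feasible M Bs → ¬ InUnion M Bs y → ExchangeArc (M j) (Bs j) u y →
                        Feasible M (exchangeAt Bs j u y)
  exchangeAt-feasible {Bs = Bs} {y = y} {j = j} {u = u} (bases , disjoint) y∉Bs (_ , _ , _ , base) =
    bases′ , disjoint′
    where
    bases′ : IsBasisSeq M (exchangeAt Bs j u y)
    bases′ i with i ≟ j
    ... | yes refl = subst (IsBase (M i)) (sym (updateAt-updates i Bs)) base
    ... | no  i≢j  = subst (IsBase (M i)) (sym (updateAt-minimal i j Bs i≢j)) (bases i)
    new-member : ∀ {x} i → x ∈ Bs j - u + y → x ∈ Bs i → j ≡ i
    new-member i x∈ x∈Bsᵢ with ∈-+⁻ x∈
    ... | inj₁ (x∈Bsⱼ , _) = disjoint j i _ x∈Bsⱼ x∈Bsᵢ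
    ... | inj₂ refl        = contradiction (i , x∈Bsᵢ) y∉Bs
    disjoint′ : PairwiseDisjoint (exchangeAt Bs j u y)
    disjoint′ i i′ x x∈ x∈′ with ∈-updateAt⁻ Bs x∈ | ∈-updateAt⁻ Bs x∈′
    ... | inj₁ (refl , _)    | inj₁ (refl , _)      = refl
    ... | inj₁ (refl , x∈S)  | inj₂ (_ , x∈Bsᵢ′)    = new-member i′ x∈S x∈Bsᵢ′
    ... | inj₂ (_ , x∈Bsᵢ)   | inj₁ (refl , x∈S)    = sym (new-member i x∈S x∈Bsᵢ)
    ... | inj₂ (_ , x∈Bsᵢ)   | inj₂ (_ , x∈Bsᵢ′)    = disjoint i i′ x x∈Bsᵢ x∈Bsᵢ′

  exchangeAt-removes : PairwiseDisjoint Bs → ExchangeArc (M j) (Bs j) u y → ¬ InUnion M (exchangeAt Bs j u y) u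
  exchangeAt-removes {Bs = Bs} {j = j} disjoint (u∈Bsⱼ , _ , y∉Bsⱼ , _) (i , u∈) with ∈-updateAt⁻ Bs u∈
  ... | inj₁ (refl , u∈S)    = ∉-+ (λ { refl → y∉Bsⱼ u∈Bsⱼ }) u∈S
  ... | inj₂ (i≢j , u∈Bsᵢ)   = i≢j (disjoint i j _ u∈Bsᵢ u∈Bsⱼ)

  -- An arc (a, b) of the walk cannot involve u or y, nor have (a, y) as an arc, without giving a shorter
  -- escaping walk; so it survives the exchange along (u, y) by exchange-persists.
  reroute : ∀ {Bs j u y x v l} → ¬ InUnion M Bs y → ExchangeArc (M j) (Bs j) u y →
            NoEscapeWithin Bs x l → Walk Bs x v l → Walk (exchangeAt Bs j u y) x v l
  reroute _ _ _ [] = []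
  reroute {Bs} {j} {u} {y} {x} {b} {suc l} y∉Bs uy@(_ , y∈Eⱼ , _ , _) noEscape (_▷_ {a} walk (i , ab)) =
    reroute y∉Bs uy (noEscape ∘ m≤n⇒m≤1+n) walk ▷ (i , ab′)
    where
    escapes : ¬ Walk Bs x y (suc l)
    escapes = noEscape ≤-refl y∉Bs
    ab′ : ExchangeArc (M i) (exchangeAt Bs j u y i) a b
    ab′ with i ≟ j
    ... | no  i≢j  = subst (λ S → ExchangeArc (M i) S a b) (sym (updateAt-minimal i j Bs i≢j)) ab
    ... | yes refl = subst (λ S → ExchangeArc (M i) S a b) (sym (updateAt-updates i Bs))
                       (exchange-persists (M i) uy ab (λ { refl → escapes (walk ▷ (i , uy)) })
                                                     (λ { refl → escapes (walk ▷ (i , ab)) })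
                                                     λ bay → escapes (walk ▷ (i , proj₁ ab , y∈Eⱼ , y∉Bsᵢ , bay)))
      where
      y∉Bsᵢ : y ∉ Bs i
      y∉Bsᵢ y∈Bsᵢ = y∉Bs (i , y∈Bsᵢ)

  module _ (x : Fin n) (coloop : ∀ Bs → IsUnionBasisOf M Bs → InUnion M Bs x) where

    no-escape : ∀ l → Feasible M Bs → NoEscapeWithin Bs x l
    no-escape l       F _         y∉Bs []                = y∉Bs (coloop _ (feasible⇒unionBasis F))
    no-escape (suc l) F (s≤s m≤l) y∉Bs (w ▷ (j , uy)) =
      no-escape l (exchangeAt-feasible F y∉Bs uy) m≤l (exchangeAt-removes (proj₂ F) uy)
        (reroute y∉Bs uy (λ m′≤m → no-escape l F (≤-trans m′≤m m≤l)) w)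

  module _ (Bs : Fin k → Subset n) where

    ReachesOutside : Fin n → Set
    ReachesOutside z = ∃[ y ] (InE M y × ¬ InUnion M Bs y × Path M Bs z y)

    reachesOutside-closed : ∀ i → PredecessorClosed (M i) ReachesOutside (Bs i)
    reachesOutside-closed i arc (y , y∈E , y∉Bs , path) = y , y∈E , y∉Bs , (i , arc) ◅ path

    unreaching-in-unionBasis : IsBasisSeq M Bs → Decidable ReachesOutside →
                               ∀ {x} → InUnion M Bs x → ¬ ReachesOutside x →
                               ∀ Bs′ → IsUnionBasisOf M Bs′ → InUnion M Bs′ x
    unreaching-in-unionBasis bases R? {x} (i , x∈Bsᵢ) x-stays Bs′ (bases′ , maximal) =
      maximal Ds (proj₁ ∘ proj₂ ∘ interpolant) Bs′⊆Ds x (i , keeps i x∈Bsᵢ x-stays)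
      where
      interpolant : ∀ i → ∃[ D ] (IsBase (M i) D × (∀ {v} → v ∈ Bs i → ¬ ReachesOutside v → v ∈ D)
                                                  × (∀ {v} → v ∈ Bs′ i → ReachesOutside v → v ∈ D))
      interpolant i = interpolating-base (M i) R? (bases i) (reachesOutside-closed i) (bases′ i)
      Ds : Fin k → Subset n
      Ds = proj₁ ∘ interpolant
      keeps : ∀ i {v} → v ∈ Bs i → ¬ ReachesOutside v → v ∈ Ds i
      keeps i = proj₁ (proj₂ (proj₂ (interpolant i)))
      covers : ∀ i {v} → v ∈ Bs′ i → ReachesOutside v → v ∈ Ds i
      covers i = proj₂ (proj₂ (proj₂ (interpolant i)))
      Bs′⊆Ds : ∀ v → InUnion M Bs′ v → InUnion M Ds v
      Bs′⊆Ds v (i , v∈Bs′ᵢ) with R? v | InUnion? Bs v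
      ... | yes reaches | _              = i , covers i v∈Bs′ᵢ reaches
      ... | no  stays   | yes (j , v∈Bsⱼ) = j , keeps j v∈Bsⱼ stays
      ... | no  stays   | no v∉Bs        =
        contradiction (v , (i , base⊆ground (M i) (bases′ i) v∈Bs′ᵢ) , v∉Bs , ε) stays

lemma3 : ∀ {n k : ℕ} (M : Fin k → Matroid n) (Bs : Fin k → Subset n) →
    Feasible M Bs →
    ∀ x → IsUnionColoop M x ⇔
          (InUnion M Bs x × (∀ y → InE M y → ¬ InUnion M Bs y → ¬ Path M Bs x y))
lemma3 M Bs F@(bases , _) x = mk⇔ forward backward
  where
  forward : IsUnionColoop M x → InUnion M Bs x × (∀ y → InE M y → ¬ InUnion M Bs y → ¬ Path M Bs x y)
  forward (_ , coloop) = coloop Bs (feasible⇒unionBasis M F) , λ y _ y∉Bs path →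
    let l , walk = path⇒walk M path in no-escape M x coloop l F ≤-refl y∉Bs walk
  -- Reachability is not decidable (being a basis is not), but a decider exists under ¬¬,
  -- which suffices since membership in ⋃ Bs′ is decidable.
  backward : InUnion M Bs x × (∀ y → InE M y → ¬ InUnion M Bs y → ¬ Path M Bs x y) → IsUnionColoop M x
  backward (x∈Bs@(i , x∈Bsᵢ) , no-path) = (i , base⊆ground (M i) (bases i) x∈Bsᵢ) , λ Bs′ unionBasis →
    decidable-stable (InUnion? M Bs′ x) λ x∉Bs′ → ¬¬-decidable (ReachesOutside M Bs) λ R? →
      x∉Bs′ (unreaching-in-unionBasis M Bs bases R? x∈Bs x-stays Bs′ unionBasis)
    where
    x-stays : ¬ ReachesOutside M Bs x
    x-stays (y , y∈E , y∉Bs , path) = no-path y y∈E y∉Bs path
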